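{- Let $\mathcal{P}$ be a mobile tree poset with underlying ribbon $\mathcal{Z}=\mathcal{Z}^{(\ell)}_S$, let $F$ be the set of path folds for $\mathcal{P}$ with induced path order $\sigma=(\sigma_0,\dots,\sigma_k)$. Then there exists a $\sigma$-partitioned regular labeling of $\mathcal{P}$.
   Context: $x\lessdot y$ means $y$ covers $x$; a cover relation is recorded as $(x,y)$. Ribbon $\mathcal{Z}^{(\ell)}_S$: poset on $z_1,\dots,z_\ell$ with $z_{i+1}\lessdot z_i$ for $i\in S$ and $z_i\lessdot z_{i+1}$ for $i\in[\ell-1]\setminus S$. Mobile tree posets: from $\mathcal{Z}$: (i) for each $z$ attach $m_z\ge0$ disjoint rooted tree posets (tree Hasse diagram, unique maximum) by making $z$ cover their roots; (ii) optionally for one $z'=z_j$ (the anchor) attach a disjoint rooted tree poset $\mathcal{Q}$ by adding $z'\lessdot q$ for some $q\in\mathcal{Q}$; take transitive closures. Free-standing means (ii) is not used. $\mathcal{P}\ominus F$ is the poset generated by the cover relations not in $F$. Path folds: $F=\{(z_{i+1},z_i): i\in S\}$ if free-standing, else $F=\{(z_{i+1},z_i): i\in S,i<j\}\cup\{(z_i,z_{i+1}): i\notin S,i\ge j\}$. The $k+1$ connected components of $\mathcal{P}\ominus F$ each contain a block of consecutive ribbon elements; ordering them by increasing indices gives the induced path order $\sigma_0,\dots,\sigma_k$. A labeling is a bijection $\omega:\mathcal{P}\to[\#\mathcal{P}]$. An injective labeling $\omega$ of a poset is regular if for all $x<z$ and all $y$, whenever $\omega(x)<\omega(y)<\omega(z)$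 or $\omega(x)>\omega(y)>\omega(z)$, we have $x<y$ or $y<z$. $\omega$ is $\sigma$-partitioned if for $i<j$, $\omega(x)<\omega(y)$ for all $x\in\sigma_i,y\in\sigma_j$; it is $\sigma$-partitioned regular if in addition its restriction to each $\sigma_i$ is a regular labeling of $\sigma_i$. -}

module Defs where

open import Data.Nat using (ℕ; suc)
import Data.Nat
open import Data.Fin using (Fin; toℕ; inject₁) renaming (suc to fsuc)
import Data.Fin as F
open import Data.Bool using (Bool; true; false)
open import Data.List using (List)
open import Data.List.Membership.Propositional using (_∈_)
open import Data.Maybe using (Maybe; just; nothing)
open import Data.Product using (Σ; _×_; _,_)
open import Data.Sum using (_⊎_)
open import Data.Unit using (⊤)
open import Data.Empty using (⊥)
open import Relation.Nullary using (¬_)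
open import Relation.Binary.PropositionalEquality using (_≡_; _≢_)
open import Relation.Binary.Construct.Closure.ReflexiveTransitive using (Star)

-- A rooted tree poset is given by its shape: a
-- node with a list of subtrees.  Its elements are positions in the tree;
-- every child root is covered by its parent (the root is the maximum).

data Tree : Set where
  node : List Tree → Tree

data Pos : Tree → Set where
  root : ∀ {t} → Pos t
  sub  : ∀ {ts t} → t ∈ ts → Pos t → Pos (node ts)

data TCov : ∀ {t} → Pos t → Pos t → Set where
  top    : ∀ {ts t} (m : t ∈ ts) → TCov (sub m root) (root {node ts})
  deeper : ∀ {ts t} (m : t ∈ ts) {p q : Pos t} → TCov p q → TCov (sub m p) (sub m q)

-- The ribbon has ℓ = suc n elements z₀,…,zₙ
-- (0-based; paper's z_{i+1} is our index i).  Ribbon edge e : Fin n joins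
-- z_e and z_{e+1}; inS e = true means e ∈ S, i.e. z_{e+1} ⋖ z_e,
-- otherwise z_e ⋖ z_{e+1}.

record Anchor (n : ℕ) : Set where
  field
    j : Fin (suc n)
    Q : Tree
    q : Pos Q           -- z_j ⋖ q

record Mobile : Set where
  field
    n      : ℕ
    inS    : Fin n → Bool
    trees  : Fin (suc n) → List Tree -- the m_z trees hanging below z
    anchor : Maybe (Anchor n)        -- nothing = free-standing

module _ (M : Mobile) where
  open Mobile M

  AncElem : Maybe (Anchor n) → Set
  AncElem nothing  = ⊥
  AncElem (just a) = Pos (Anchor.Q a)

  data Elem : Set where
    rib : Fin (suc n) → Elem
    att : (z : Fin (suc n)) {t : Tree} → t ∈ trees z → Pos t → Elem
    anc : AncElem anchor → Elem

  AncCov : (ma : Maybe (Anchor n)) → AncElem ma → AncElem ma → Set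
  AncCov nothing  () _
  AncCov (just a) p q = TCov p q

  AncLink : (ma : Maybe (Anchor n)) → Fin (suc n) → AncElem ma → Set
  AncLink nothing  z ()
  AncLink (just a) z p = (z ≡ Anchor.j a) × (p ≡ Anchor.q a)

  data Cov : Elem → Elem → Set where
    ribUp   : (e : Fin n) → inS e ≡ false → Cov (rib (inject₁ e)) (rib (fsuc e))
    ribDown : (e : Fin n) → inS e ≡ true  → Cov (rib (fsuc e)) (rib (inject₁ e))
    attRoot : (z : Fin (suc n)) {t : Tree} (m : t ∈ trees z) → Cov (att z m root) (rib z)
    attIn   : (z : Fin (suc n)) {t : Tree} (m : t ∈ trees z) {p q : Pos t} →
              TCov p q → Cov (att z m p) (att z m q)
    ancUp   : (z : Fin (suc n)) (p : AncElem anchor) → AncLink anchor z p → Cov (rib z) (anc p)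
    ancIn   : (p q : AncElem anchor) → AncCov anchor p q → Cov (anc p) (anc q)

  _≤P_ : Elem → Elem → Set
  _≤P_ = Star Cov

  FoldDown : Maybe (Anchor n) → Fin n → Set
  FoldDown nothing  e = ⊤
  FoldDown (just a) e = toℕ e Data.Nat.< toℕ (Anchor.j a)

  FoldUp : Maybe (Anchor n) → Fin n → Set
  FoldUp nothing  e = ⊥
  FoldUp (just a) e = toℕ (Anchor.j a) Data.Nat.≤ toℕ e

  Folded : ∀ {x y} → Cov x y → Set
  Folded (ribUp e _)   = FoldUp anchor e
  Folded (ribDown e _) = FoldDown anchor e
  Folded (attRoot _ _) = ⊥
  Folded (attIn _ _ _) = ⊥
  Folded (ancUp _ _ _) = ⊥
  Folded (ancIn _ _ _) = ⊥

  Kept : Elem → Elem → Set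
  Kept x y = Σ (Cov x y) λ c → ¬ Folded c

  _≤F_ : Elem → Elem → Set
  _≤F_ = Star Kept

  _<F_ : Elem → Elem → Set
  x <F y = (x ≤F y) × (x ≢ y)

  _~_ : Elem → Elem → Set
  _~_ = Star (λ x y → Kept x y ⊎ Kept y x)

  -- σ-partitioned: components are ordered by the indices of their ribbon
  -- elements; an element of an earlier component gets a smaller label.
  σ-Partitioned : {N : ℕ} → (Elem → Fin N) → Set
  σ-Partitioned ω = ∀ {x y : Elem} (a b : Fin (suc n)) → a F.< b →
    x ~ rib a → y ~ rib b → ¬ (x ~ y) → ω x F.< ω y

  RegularOnComponents : {N : ℕ} → (Elem → Fin N) → Set
  RegularOnComponents ω = ∀ {x y z : Elem} → x ~ y → y ~ z → x <F z →
    ((ω x F.< ω y × ω y F.< ω z) ⊎ (ω z F.< ω y × ω y F.< ω x)) →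
    (x <F y) ⊎ (y <F z)

  σ-PartitionedRegular : {N : ℕ} → (Elem → Fin N) → Set
  σ-PartitionedRegular ω = σ-Partitioned ω × RegularOnComponents ω

-- P ⊖ F is a forest: the folds delete, at every ribbon element, the ribbon covers that do not
-- point towards the anchor z_j (towards the last ribbon element when P is free-standing), so every
-- element keeps at most one upper cover, and a height decreasing along kept covers shows that every
-- element lies below a unique root.  Label the elements in depth-first preorder, i.e. by the
-- lexicographic order of their root-to-element paths, each element being encoded by a list of
-- naturals that begins with its ribbon index.  A preorder labeling is regular because the
-- descendants of z receive an interval of labels starting right after z.  It is σ-partitioned
-- because two ribbon elements lie in different components only if a folded ribbon edge separates
-- them; no kept cover crosses such an edge, so the root of a component further right has a larger
-- ribbon index.

module Submission where

open import Defs
open import Data.Bool as Bool using (true; false)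
open import Data.Empty using (⊥; ⊥-elim)
open import Data.Fin as Fin using (Fin; toℕ; inject₁) renaming (suc to fsuc)
open import Data.Fin.Induction using (<-weakInduction-startingFrom)
import Data.Fin.Properties as Fin
open import Data.List using (List; []; _∷_; _++_; _∷ʳ_; [_]; foldr; length; lookup; map; concatMap; allFin)
open import Data.List.Membership.Propositional using (_∈_)
open import Data.List.Membership.Propositional.Properties
  using (∈-lookup; ∈-++⁺ˡ; ∈-++⁺ʳ; ∈-map⁺; ∈-concatMap⁺; ∈-allFin)
open import Data.List.Properties
  using (∷-injectiveˡ; ∷-injectiveʳ; ∷ʳ-injective; ∷ʳ-injectiveˡ; ++-identityʳ; ++-assoc)
open import Data.List.Relation.Binary.Lex.Core using (halt; this; next)
open import Data.List.Relation.Binary.Lex.Strict using (Lex-<; <-isStrictTotalOrder)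
open import Data.List.Relation.Binary.Pointwise using (Pointwise-≡⇒≡)
open import Data.List.Relation.Unary.All as All using (All; []; _∷_)
open import Data.List.Relation.Unary.AllPairs using (AllPairs; []; _∷_)
open import Data.List.Relation.Unary.Any as Any using (here; there; index)
open import Data.List.Relation.Unary.Any.Properties using (lookup-index)
open import Data.List.Reverse using (reverseView; []; _∶_∶ʳ_)
open import Data.Maybe using (Maybe; just; nothing)
open import Data.Nat as ℕ using (ℕ; zero; suc; _+_; s≤s; z≤n)
import Data.Nat.Induction as ℕ
import Data.Nat.Properties as ℕ
open import Data.Product using (Σ; ∃; ∃₂; _×_; _,_; proj₁; proj₂; map₂)
open import Data.Sum using (_⊎_; inj₁; inj₂; swap)
open import Data.Unit using (tt)
open import Function using (_∘_; _on_; flip; _⇔_; mk⇔; Equivalence)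
open import Function.Bundles using (_⤖_; Bijection; mk⤖)
open import Function.Definitions using (Injective)
open import Function.Properties.Equivalence using (⇔-isEquivalence)
open import Induction.WellFounded using (WellFounded; Acc; acc; module Subrelation)
open import Level using (Level; 0ℓ)
open import Relation.Binary.Core using (Rel)
open import Relation.Binary.Construct.Closure.ReflexiveTransitive as Star using (Star; ε; _◅_; _◅◅_)
import Relation.Binary.Construct.On as On
open import Relation.Binary.Definitions using (Asymmetric; Trichotomous; tri<; tri≈; tri>)
open import Relation.Binary.Morphism.Structures using (IsOrderIsomorphism)
open import Relation.Binary.PropositionalEquality
  using (_≡_; _≢_; refl; sym; trans; cong; subst; subst₂)
import Relation.Binary.PropositionalEquality as ≡
open import Relation.Binary.Structures using (IsEquivalence; IsStrictTotalOrder)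
open import Relation.Nullary using (¬_; Dec; yes; no)
open import Relation.Nullary.Decidable using (_×-dec_; ¬?)
import Relation.Nullary.Decidable as Dec

open IsEquivalence (⇔-isEquivalence {ℓ = 0ℓ})
  using () renaming (refl to ⇔-refl; sym to ⇔-sym; trans to ⇔-trans)

private
  variable
    a ℓ ℓ₁ : Level
    A B : Set a

isStrictTotalOrder-≡ : {_≈_ : Rel A ℓ₁} {_<_ : Rel A ℓ} → (∀ {x y} → x ≈ y → x ≡ y) →
                       IsStrictTotalOrder _≈_ _<_ → IsStrictTotalOrder _≡_ _<_
isStrictTotalOrder-≡ {_<_ = _<_} ≈⇒≡ sto = record
  { isStrictPartialOrder = record
    { isEquivalence = ≡.isEquivalence
    ; irrefl        = λ { refl → S.irrefl S.Eq.refl }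
    ; trans         = S.trans
    ; <-resp-≈      = (λ { refl p → p }) , (λ { refl p → p })
    }
  ; compare = compare-≡
  }
  where
  module S = IsStrictTotalOrder sto
  compare-≡ : Trichotomous _≡_ _<_
  compare-≡ x y with S.compare x y
  ... | tri< x<y x≉y y≮x = tri< x<y (λ { refl → x≉y S.Eq.refl }) y≮x
  ... | tri≈ x≮y x≈y y≮x = tri≈ x≮y (≈⇒≡ x≈y) y≮x
  ... | tri> x≮y x≉y y<x = tri> x≮y (λ { refl → x≉y S.Eq.refl }) y<x

Lex-isStrictTotalOrder : {_<_ : Rel A ℓ} → IsStrictTotalOrder _≡_ _<_ →
                         IsStrictTotalOrder _≡_ (Lex-< _≡_ _<_)
Lex-isStrictTotalOrder sto = isStrictTotalOrder-≡ Pointwise-≡⇒≡ (<-isStrictTotalOrder sto)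

On-isStrictTotalOrder : {_<_ : Rel B ℓ} (f : A → B) → Injective _≡_ _≡_ f →
                        IsStrictTotalOrder _≡_ _<_ → IsStrictTotalOrder _≡_ (_<_ on f)
On-isStrictTotalOrder f f-injective sto =
  isStrictTotalOrder-≡ f-injective (On.isStrictTotalOrder f sto)

module _ {_<_ : Rel A ℓ} where

  Lex-<-++ : ∀ xs {y ys} → Lex-< _≡_ _<_ xs (xs ++ y ∷ ys)
  Lex-<-++ []       = halt
  Lex-<-++ (x ∷ xs) = next refl (Lex-<-++ xs)

  Lex-<-between-extension : Asymmetric _<_ → ∀ xs {ys zs} →
                            Lex-< _≡_ _<_ xs ys → Lex-< _≡_ _<_ ys (xs ++ zs) →
                            ∃₂ λ y ys′ → ys ≡ xs ++ y ∷ ys′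
  Lex-<-between-extension asym []       halt             _                = _ , _ , refl
  Lex-<-between-extension asym (x ∷ xs) (this x<y)       (this y<x)       = ⊥-elim (asym x<y y<x)
  Lex-<-between-extension asym (x ∷ xs) (this x<x)       (next refl _)    = ⊥-elim (asym x<x x<x)
  Lex-<-between-extension asym (x ∷ xs) (next refl _)    (this x<x)       = ⊥-elim (asym x<x x<x)
  Lex-<-between-extension asym (x ∷ xs) (next refl xs<ys) (next refl ys<xs++zs)
    with y , ys′ , eq ← Lex-<-between-extension asym xs xs<ys ys<xs++zs = y , ys′ , cong (x ∷_) eq

module _ {_<_ : Rel A ℓ} (sto : IsStrictTotalOrder _≡_ _<_) where

  open IsStrictTotalOrder sto using (compare; irrefl; asym) renaming (trans to <-trans)

  insert : A → List A → List A
  insert x []       = x ∷ []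
  insert x (y ∷ ys) with compare x y
  ... | tri< _ _ _ = x ∷ y ∷ ys
  ... | tri≈ _ _ _ = y ∷ ys
  ... | tri> _ _ _ = y ∷ insert x ys

  All-insert : ∀ {p} {P : A → Set p} {x} ys → P x → All P ys → All P (insert x ys)
  All-insert []       px []         = px ∷ []
  All-insert {x = x} (y ∷ ys) px (py ∷ pys) with compare x y
  ... | tri< _ _ _ = px ∷ py ∷ pys
  ... | tri≈ _ _ _ = py ∷ pys
  ... | tri> _ _ _ = py ∷ All-insert ys px pys

  AllPairs-insert : ∀ {x} ys → AllPairs _<_ ys → AllPairs _<_ (insert x ys)
  AllPairs-insert []       []         = [] ∷ []
  AllPairs-insert {x} (y ∷ ys) (y<ys ∷ s) with compare x y
  ... | tri< x<y _ _ = (x<y ∷ All.map (<-trans x<y) y<ys) ∷ y<ys ∷ s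
  ... | tri≈ _ _ _   = y<ys ∷ s
  ... | tri> _ _ y<x = All-insert ys y<x y<ys ∷ AllPairs-insert ys s

  ∈-insert : ∀ x ys → x ∈ insert x ys
  ∈-insert x []       = here refl
  ∈-insert x (y ∷ ys) with compare x y
  ... | tri< _ _ _    = here refl
  ... | tri≈ _ x≡y _  = here x≡y
  ... | tri> _ _ _    = there (∈-insert x ys)

  ∈-insert⁺ : ∀ x {y} ys → y ∈ ys → y ∈ insert x ys
  ∈-insert⁺ x (z ∷ zs) y∈ys with compare x z
  ... | tri< _ _ _ = there y∈ys
  ... | tri≈ _ _ _ = y∈ys
  ∈-insert⁺ x (z ∷ zs) (here y≡z)  | tri> _ _ _ = here y≡z
  ∈-insert⁺ x (z ∷ zs) (there y∈zs) | tri> _ _ _ = there (∈-insert⁺ x zs y∈zs)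

  sort : List A → List A
  sort = foldr insert []

  sort-AllPairs : ∀ xs → AllPairs _<_ (sort xs)
  sort-AllPairs []       = []
  sort-AllPairs (x ∷ xs) = AllPairs-insert (sort xs) (sort-AllPairs xs)

  ∈-sort : ∀ {x xs} → x ∈ xs → x ∈ sort xs
  ∈-sort {xs = y ∷ xs} (here refl) = ∈-insert y (sort xs)
  ∈-sort {xs = y ∷ xs} (there x∈xs) = ∈-insert⁺ y (sort xs) (∈-sort x∈xs)

  lookup-strictlyMonotone : ∀ {xs} → AllPairs _<_ xs → ∀ {i j} → i Fin.< j → lookup xs i < lookup xs j
  lookup-strictlyMonotone (x<xs ∷ _)  {Fin.zero}  {Fin.suc j} _           = All.lookup x<xs (∈-lookup j)
  lookup-strictlyMonotone (_ ∷ sorted) {Fin.suc i} {Fin.suc j} (ℕ.s≤s i<j) = lookup-strictlyMonotone sorted i<j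

  lookup-injective : ∀ {xs} → AllPairs _<_ xs → ∀ {i j} → lookup xs i ≡ lookup xs j → i ≡ j
  lookup-injective sorted {i} {j} eq with Fin.<-cmp i j
  ... | tri< i<j _ _ = ⊥-elim (irrefl eq (lookup-strictlyMonotone sorted i<j))
  ... | tri≈ _ i≡j _ = i≡j
  ... | tri> _ _ j<i = ⊥-elim (irrefl (sym eq) (lookup-strictlyMonotone sorted j<i))

  rank-isOrderIsomorphism : (xs : List A) → (∀ x → x ∈ xs) →
    Σ ℕ λ N → Σ (A → Fin N) (IsOrderIsomorphism _≡_ _≡_ _<_ Fin._<_)
  rank-isOrderIsomorphism xs complete = length ys , rank , record
    { isOrderMonomorphism = record
      { isOrderHomomorphism = record { cong = cong rank ; mono = rank-mono }
      ; injective           = rank-injective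
      ; cancel              = rank-cancel
      }
    ; surjective = λ i → lookup ys i , λ { refl → lookup-injective sorted (sym (lookup-rank (lookup ys i))) }
    }
    where
    ys : List A
    ys = sort xs

    sorted : AllPairs _<_ ys
    sorted = sort-AllPairs xs

    rank : A → Fin (length ys)
    rank x = index (∈-sort (complete x))

    lookup-rank : ∀ x → x ≡ lookup ys (rank x)
    lookup-rank x = lookup-index (∈-sort (complete x))

    rank-injective : ∀ {x y} → rank x ≡ rank y → x ≡ y
    rank-injective {x} {y} eq = trans (lookup-rank x) (trans (cong (lookup ys) eq) (sym (lookup-rank y)))

    rank-cancel : ∀ {x y} → rank x Fin.< rank y → x < y
    rank-cancel {x} {y} lt = subst₂ _<_ (sym (lookup-rank x)) (sym (lookup-rank y))
                                     (lookup-strictlyMonotone sorted lt)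

    rank-mono : ∀ {x y} → x < y → rank x Fin.< rank y
    rank-mono {x} {y} x<y with Fin.<-cmp (rank x) (rank y)
    ... | tri< lt _ _ = lt
    ... | tri≈ _ eq _ = ⊥-elim (irrefl (rank-injective eq) x<y)
    ... | tri> _ _ gt = ⊥-elim (asym x<y (rank-cancel gt))

module RootedForest
  {E C : Set} (_⋖_ : Rel E 0ℓ)
  (⋖-functional : ∀ {x y y′} → x ⋖ y → x ⋖ y′ → y ≡ y′)
  (upper? : ∀ x → Dec (∃ (x ⋖_)))
  (height : E → ℕ) (height-⋖ : ∀ {x y} → x ⋖ y → height y ℕ.< height x)
  (code : E → C) (code-injective : Injective _≡_ _≡_ code)
  where

  _⋖*_ : Rel E 0ℓ
  _⋖*_ = Star _⋖_

  data RootPath : E → List C → Set where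
    maximal : ∀ {x} → ¬ ∃ (x ⋖_) → RootPath x [ code x ]
    covered : ∀ {x y ps} → x ⋖ y → RootPath y ps → RootPath x (ps ∷ʳ code x)

  RootPath-functional : ∀ {x ps qs} → RootPath x ps → RootPath x qs → ps ≡ qs
  RootPath-functional (maximal _)     (maximal _)      = refl
  RootPath-functional (maximal ¬up)   (covered x⋖y _)  = ⊥-elim (¬up (_ , x⋖y))
  RootPath-functional (covered x⋖y _) (maximal ¬up)    = ⊥-elim (¬up (_ , x⋖y))
  RootPath-functional {x} (covered x⋖y p) (covered x⋖y′ q) with refl ← ⋖-functional x⋖y x⋖y′ =
    cong (_∷ʳ code x) (RootPath-functional p q)

  RootPath-last : ∀ {x ps} → RootPath x ps → ∃ λ qs → ps ≡ qs ∷ʳ code x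
  RootPath-last (maximal _)          = [] , refl
  RootPath-last (covered {ps = ps} _ _) = ps , refl

  RootPath-head : ∀ {x ps} → RootPath x ps → ∃₂ λ r qs → x ⋖* r × ps ≡ code r ∷ qs
  RootPath-head (maximal _) = _ , [] , ε , refl
  RootPath-head {x} (covered x⋖y p) with r , qs , y⋖*r , refl ← RootPath-head p =
    r , qs ∷ʳ code x , x⋖y ◅ y⋖*r , refl

  RootPath-prefix : ∀ {x ps q qs rs} → RootPath x ps → ps ≡ (q ∷ qs) ++ rs →
                    ∃ λ w → x ⋖* w × RootPath w (q ∷ qs)
  RootPath-prefix {qs = []}    {[]}    (maximal ¬up) refl = _ , ε , maximal ¬up
  RootPath-prefix {qs = []}    {_ ∷ _} (maximal _)   ()
  RootPath-prefix {qs = _ ∷ _}         (maximal _)   ()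
  RootPath-prefix {q = q} {qs} {rs} (covered {ps = ps} x⋖y p) eq with reverseView rs
  ... | [] = _ , ε , subst (RootPath _) (trans eq (++-identityʳ (q ∷ qs))) (covered x⋖y p)
  ... | rs′ ∶ _ ∶ʳ r
    with w , y⋖*w , pw ← RootPath-prefix p (∷ʳ-injectiveˡ ps ((q ∷ qs) ++ rs′)
                                               (trans eq (sym (++-assoc (q ∷ qs) rs′ [ r ])))) =
    w , x⋖y ◅ y⋖*w , pw

  rootPath : ∀ x → ∃ (RootPath x)
  rootPath x = build x (⋖-wellFounded x)
    where
    ⋖-wellFounded : WellFounded (flip _⋖_)
    ⋖-wellFounded = Subrelation.wellFounded height-⋖ (On.wellFounded height ℕ.<-wellFounded)

    build : ∀ x → Acc (flip _⋖_) x → ∃ (RootPath x)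
    build x (acc rs) with upper? x
    ... | no ¬up          = _ , maximal ¬up
    ... | yes (y , x⋖y) = _ , covered x⋖y (proj₂ (build y (rs x⋖y)))

  path : E → List C
  path x = proj₁ (rootPath x)

  path-⋖ : ∀ {x y} → x ⋖ y → path x ≡ path y ∷ʳ code x
  path-⋖ {x} {y} x⋖y = RootPath-functional (proj₂ (rootPath x)) (covered x⋖y (proj₂ (rootPath y)))

  path-injective : Injective _≡_ _≡_ path
  path-injective {x} {y} eq
    with ps , eqx ← RootPath-last (proj₂ (rootPath x))
       | qs , eqy ← RootPath-last (proj₂ (rootPath y)) =
    code-injective (proj₂ (∷ʳ-injective ps qs (trans (sym eqx) (trans eq eqy))))

  path-head : ∀ x → ∃₂ λ r qs → x ⋖* r × path x ≡ code r ∷ qs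
  path-head x = RootPath-head (proj₂ (rootPath x))

  ⋖*-path-prefix : ∀ {x z} → x ⋖* z → ∃ λ S → path x ≡ path z ++ S
  ⋖*-path-prefix {x} ε = [] , sym (++-identityʳ (path x))
  ⋖*-path-prefix {x} (x⋖y ◅ y⋖*z) with S , eq ← ⋖*-path-prefix y⋖*z =
    S ∷ʳ code x , trans (path-⋖ x⋖y) (trans (cong (_∷ʳ code x) eq) (++-assoc (path _) S [ code x ]))

  path-prefix-⋖* : ∀ {x z} S → path x ≡ path z ++ S → x ⋖* z
  path-prefix-⋖* {x} {z} S eq with _ , _ , _ , eqz ← path-head z
    with w , x⋖*w , pw ← RootPath-prefix (proj₂ (rootPath x)) (trans eq (cong (_++ S) eqz)) =
    subst (x ⋖*_) (path-injective (trans (RootPath-functional (proj₂ (rootPath w)) pw) (sym eqz))) x⋖*w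

  module PathOrder {_<_ : Rel C 0ℓ} (<-isStrictTotalOrder : IsStrictTotalOrder _≡_ _<_) where

    _≺_ : Rel E 0ℓ
    _≺_ = Lex-< _≡_ _<_ on path

    ≺-isStrictTotalOrder : IsStrictTotalOrder _≡_ _≺_
    ≺-isStrictTotalOrder =
      On-isStrictTotalOrder path path-injective (Lex-isStrictTotalOrder <-isStrictTotalOrder)

    open IsStrictTotalOrder <-isStrictTotalOrder using (asym)

    ≺-ancestor : ∀ {x z} → x ⋖* z → x ≢ z → z ≺ x
    ≺-ancestor {x} {z} x⋖*z x≢z with ⋖*-path-prefix x⋖*z
    ... | [] , eq    = ⊥-elim (x≢z (path-injective (trans eq (++-identityʳ (path z)))))
    ... | _ ∷ _ , eq = subst (Lex-< _≡_ _ (path z)) (sym eq) (Lex-<-++ (path z))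

    ≺-between-ancestor : ∀ {x y z} → x ⋖* z → z ≺ y → y ≺ x → y ⋖* z
    ≺-between-ancestor {x} {y} {z} x⋖*z z≺y y≺x
      with S , eq ← ⋖*-path-prefix x⋖*z
      with s , S′ , eq′ ← Lex-<-between-extension asym (path z) z≺y (subst (Lex-< _≡_ _ (path y)) eq y≺x) =
      path-prefix-⋖* (s ∷ S′) eq′

    ≺-by-ancestors : ∀ {x y} → (∀ {r r′} → x ⋖* r → y ⋖* r′ → code r < code r′) → x ≺ y
    ≺-by-ancestors {x} {y} ancestors<
      with _ , _ , x⋖*r , eqx ← path-head x
         | _ , _ , y⋖*r′ , eqy ← path-head y =
      subst₂ (Lex-< _≡_ _) (sym eqx) (sym eqy) (this (ancestors< x⋖*r y⋖*r′))

    private module ≺ = IsStrictTotalOrder ≺-isStrictTotalOrder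

    ≺-regular : ∀ {x y z} → x ⋖* z → x ≢ z → (x ≺ y × y ≺ z) ⊎ (z ≺ y × y ≺ x) →
                y ⋖* z × y ≢ z
    ≺-regular x⋖*z x≢z (inj₁ (x≺y , y≺z)) =
      ⊥-elim (≺.asym (≺.trans x≺y y≺z) (≺-ancestor x⋖*z x≢z))
    ≺-regular x⋖*z _   (inj₂ (z≺y , y≺x)) =
      ≺-between-ancestor x⋖*z z≺y y≺x , λ { refl → ≺.irrefl refl z≺y }

depth : ∀ {t} → Pos t → ℕ
depth root      = 0
depth (sub _ p) = suc (depth p)

depth-TCov : ∀ {t} {p q : Pos t} → TCov p q → depth q ℕ.< depth p
depth-TCov (top _)      = s≤s z≤n
depth-TCov (deeper _ c) = s≤s (depth-TCov c)

TCov-functional : ∀ {t} {p q q′ : Pos t} → TCov p q → TCov p q′ → q ≡ q′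
TCov-functional (top _)      (top _)       = refl
TCov-functional (deeper m c) (deeper _ c′) = cong (sub m) (TCov-functional c c′)

parentPos : ∀ {ts t} (m : t ∈ ts) (p : Pos t) → ∃ (TCov (sub m p))
parentPos m root      = root , top m
parentPos m (sub k p) with q , c ← parentPos k p = sub m q , deeper m c

SubPos : List Tree → Set
SubPos ts = Σ Tree λ t → t ∈ ts × Pos t

mutual
  positions : (t : Tree) → List (Pos t)
  positions (node ts) = root ∷ map (λ { (_ , m , p) → sub m p }) (subPositions ts)

  subPositions : (ts : List Tree) → List (SubPos ts)
  subPositions []       = []
  subPositions (t ∷ ts) = map (λ p → t , here refl , p) (positions t)
                       ++ map (λ { (t′ , m , p) → t′ , there m , p }) (subPositions ts)

mutual
  ∈-positions : ∀ {t} (p : Pos t) → p ∈ positions t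
  ∈-positions {node _} root      = here refl
  ∈-positions {node _} (sub m p) = there (∈-map⁺ _ (∈-subPositions m p))

  ∈-subPositions : ∀ {ts t} (m : t ∈ ts) (p : Pos t) → (t , m , p) ∈ subPositions ts
  ∈-subPositions (here refl) p = ∈-++⁺ˡ (∈-map⁺ _ (∈-positions p))
  ∈-subPositions (there m)   p = ∈-++⁺ʳ _ (∈-map⁺ _ (∈-subPositions m p))

index-injective : ∀ {ts t t′} (m : t ∈ ts) (m′ : t′ ∈ ts) → index m ≡ index m′ →
                  _≡_ {A = Σ Tree (_∈ ts)} (t , m) (t′ , m′)
index-injective (here refl) (here refl) _  = refl
index-injective (there m)   (there m′)  eq = cong (map₂ there) (index-injective m m′ (Fin.suc-injective eq))

address : ∀ {t} → Pos t → List ℕ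
address root      = []
address (sub m p) = toℕ (index m) ∷ address p

address-injective : ∀ {t} (p q : Pos t) → address p ≡ address q → p ≡ q
address-injective root      root      _  = refl
address-injective (sub m p) (sub m′ q) eq
  with refl ← index-injective m m′ (Fin.toℕ-injective (∷-injectiveˡ eq)) =
  cong (sub m) (address-injective p q (∷-injectiveʳ eq))

module _ (M : Mobile) where

  open Mobile M

  -- Kept ribbon covers point towards this ribbon index.
  target : Maybe (Anchor n) → ℕ
  target nothing  = n
  target (just a) = toℕ (Anchor.j a)

  ¬FoldUp⇒<target : ∀ ma (e : Fin n) → ¬ FoldUp M ma e → toℕ e ℕ.< target ma
  ¬FoldUp⇒<target nothing  e _  = Fin.toℕ<n e
  ¬FoldUp⇒<target (just a) e nf = ℕ.≰⇒> nf

  ¬FoldDown⇒target≤ : ∀ ma (e : Fin n) → ¬ FoldDown M ma e → target ma ℕ.≤ toℕ e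
  ¬FoldDown⇒target≤ nothing  e nf = ⊥-elim (nf tt)
  ¬FoldDown⇒target≤ (just a) e nf = ℕ.≮⇒≥ nf

  AncLink⇒target : ∀ ma {i p} → AncLink M ma i p → toℕ i ≡ target ma
  AncLink⇒target (just a) (i≡j , _) = cong toℕ i≡j

  foldUp? : ∀ ma (e : Fin n) → Dec (FoldUp M ma e)
  foldUp? nothing  e = no λ ()
  foldUp? (just a) e = toℕ (Anchor.j a) ℕ.≤? toℕ e

  foldDown? : ∀ ma (e : Fin n) → Dec (FoldDown M ma e)
  foldDown? nothing  e = yes tt
  foldDown? (just a) e = toℕ e ℕ.<? toℕ (Anchor.j a)

  AncLink? : ∀ ma i → Dec (∃ (AncLink M ma i))
  AncLink? nothing  i = no λ ()
  AncLink? (just a) i = Dec.map′ (λ i≡j → Anchor.q a , i≡j , refl) (λ { (_ , i≡j , _) → i≡j })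
                                 (i Fin.≟ Anchor.j a)

  data RibbonCover (i : Fin (suc n)) : Elem M → Set where
    up   : ∀ e → inject₁ e ≡ i → inS e ≡ false → ¬ FoldUp M anchor e →
           RibbonCover i (rib (fsuc e))
    down : ∀ e → fsuc e ≡ i → inS e ≡ true → ¬ FoldDown M anchor e →
           RibbonCover i (rib (inject₁ e))
    link : ∀ p → AncLink M anchor i p → RibbonCover i (anc p)

  Kept⇒RibbonCover : ∀ {i y} → Kept M (rib i) y → RibbonCover i y
  Kept⇒RibbonCover (ribUp e s , nu)   = up e refl s nu
  Kept⇒RibbonCover (ribDown e s , nd) = down e refl s nd
  Kept⇒RibbonCover (ancUp _ p l , _)  = link p l

  RibbonCover⇒Kept : ∀ {i y} → RibbonCover i y → Kept M (rib i) y
  RibbonCover⇒Kept (up e refl s nu)   = ribUp e s , nu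
  RibbonCover⇒Kept (down e refl s nd) = ribDown e s , nd
  RibbonCover⇒Kept (link p l)         = ancUp _ p l , λ ()

  AncLink-functional : ∀ ma {i p p′} → AncLink M ma i p → AncLink M ma i p′ → p ≡ p′
  AncLink-functional (just a) (_ , refl) (_ , refl) = refl

  up-down-exclusive : ∀ e e′ → inject₁ e ≡ fsuc e′ →
                      ¬ FoldUp M anchor e → ¬ FoldDown M anchor e′ → ⊥
  up-down-exclusive e e′ eq nu nd = ℕ.<⇒≱ e′<target (¬FoldDown⇒target≤ anchor e′ nd)
    where
    e′<target : toℕ e′ ℕ.< target anchor
    e′<target = ℕ.<-trans (ℕ.n<1+n (toℕ e′))
      (subst (ℕ._< target anchor) (trans (sym (Fin.toℕ-inject₁ e)) (cong toℕ eq))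
             (¬FoldUp⇒<target anchor e nu))

  up-link-exclusive : ∀ e {i p} → inject₁ e ≡ i → ¬ FoldUp M anchor e → AncLink M anchor i p → ⊥
  up-link-exclusive e eq nu l =
    ℕ.<-irrefl (trans (trans (sym (Fin.toℕ-inject₁ e)) (cong toℕ eq)) (AncLink⇒target anchor l))
               (¬FoldUp⇒<target anchor e nu)

  down-link-exclusive : ∀ e {i p} → fsuc e ≡ i → ¬ FoldDown M anchor e → AncLink M anchor i p → ⊥
  down-link-exclusive e eq nd l =
    ℕ.<⇒≱ (subst (toℕ e ℕ.<_) (trans (cong toℕ eq) (AncLink⇒target anchor l)) (ℕ.n<1+n (toℕ e)))
          (¬FoldDown⇒target≤ anchor e nd)

  RibbonCover-functional : ∀ {i y y′} → RibbonCover i y → RibbonCover i y′ → y ≡ y′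
  RibbonCover-functional (up e eq _ _)    (up e′ eq′ _ _)    =
    cong (rib ∘ fsuc) (Fin.inject₁-injective (trans eq (sym eq′)))
  RibbonCover-functional (down e eq _ _)  (down e′ eq′ _ _)  =
    cong (rib ∘ inject₁) (Fin.suc-injective (trans eq (sym eq′)))
  RibbonCover-functional (link p l)       (link p′ l′)       = cong anc (AncLink-functional anchor l l′)
  RibbonCover-functional (up e eq _ nu)   (down e′ eq′ _ nd) =
    ⊥-elim (up-down-exclusive e e′ (trans eq (sym eq′)) nu nd)
  RibbonCover-functional (down e eq _ nd) (up e′ eq′ _ nu)   =
    ⊥-elim (up-down-exclusive e′ e (trans eq′ (sym eq)) nu nd)
  RibbonCover-functional (up e eq _ nu)   (link p l)         = ⊥-elim (up-link-exclusive e eq nu l)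
  RibbonCover-functional (link p l)       (up e eq _ nu)     = ⊥-elim (up-link-exclusive e eq nu l)
  RibbonCover-functional (down e eq _ nd) (link p l)         = ⊥-elim (down-link-exclusive e eq nd l)
  RibbonCover-functional (link p l)       (down e eq _ nd)   = ⊥-elim (down-link-exclusive e eq nd l)

  RibbonCover? : ∀ i → Dec (∃ (RibbonCover i))
  RibbonCover? i
    with Fin.any? (λ e → inject₁ e Fin.≟ i ×-dec inS e Bool.≟ false ×-dec ¬? (foldUp? anchor e))
       | Fin.any? (λ e → fsuc e Fin.≟ i ×-dec inS e Bool.≟ true ×-dec ¬? (foldDown? anchor e))
       | AncLink? anchor i
  ... | yes (e , eq , s , nu) | _                     | _           = yes (_ , up e eq s nu)
  ... | no _                  | yes (e , eq , s , nd) | _           = yes (_ , down e eq s nd)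
  ... | no _                  | no _                  | yes (p , l) = yes (_ , link p l)
  ... | no ¬up                | no ¬down              | no ¬link    = no λ where
    (_ , up e eq s nu)   → ¬up (e , eq , s , nu)
    (_ , down e eq s nd) → ¬down (e , eq , s , nd)
    (_ , link p l)       → ¬link (p , l)

  AncCov? : ∀ ma (p : AncElem M ma) → Dec (∃ (AncCov M ma p))
  AncCov? (just a) root      = no λ ()
  AncCov? (just a) (sub m p) = yes (parentPos m p)

  Kept-upper? : ∀ x → Dec (∃ (Kept M x))
  Kept-upper? (rib i)             = Dec.map′ (map₂ RibbonCover⇒Kept) (map₂ Kept⇒RibbonCover) (RibbonCover? i)
  Kept-upper? (att z m root)      = yes (rib z , attRoot z m , λ ())
  Kept-upper? (att z m (sub k p)) with q , c ← parentPos k p = yes (att z m q , attIn z m c , λ ())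
  Kept-upper? (anc p)             = Dec.map′ (λ { (q , c) → anc q , ancIn p q c , λ () })
                                             (λ { (_ , ancIn _ q c , _) → q , c }) (AncCov? anchor p)

  AncCov-functional : ∀ ma {p q q′ : AncElem M ma} → AncCov M ma p q → AncCov M ma p q′ → q ≡ q′
  AncCov-functional (just a) = TCov-functional

  Kept-functional : ∀ {x y y′} → Kept M x y → Kept M x y′ → y ≡ y′
  Kept-functional {rib i} k k′ = RibbonCover-functional (Kept⇒RibbonCover k) (Kept⇒RibbonCover k′)
  Kept-functional (attRoot _ _ , _) (attRoot _ _ , _)  = refl
  Kept-functional (attIn z m c , _) (attIn _ _ c′ , _) = cong (att z m) (TCov-functional c c′)
  Kept-functional (ancIn _ _ c , _) (ancIn _ _ c′ , _) = cong anc (AncCov-functional anchor c c′)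

  ∣1+m-n∣<∣m-n∣ : ∀ {m n} → m ℕ.< n → ℕ.∣ suc m - n ∣ ℕ.< ℕ.∣ m - n ∣
  ∣1+m-n∣<∣m-n∣ {zero}  {suc n} _         = ℕ.n<1+n n
  ∣1+m-n∣<∣m-n∣ {suc m} {suc n} (s≤s m<n) = ∣1+m-n∣<∣m-n∣ m<n

  ∣m-n∣<∣1+m-n∣ : ∀ {m n} → n ℕ.≤ m → ℕ.∣ m - n ∣ ℕ.< ℕ.∣ suc m - n ∣
  ∣m-n∣<∣1+m-n∣ {zero}  {zero}  _         = ℕ.n<1+n 0
  ∣m-n∣<∣1+m-n∣ {suc m} {zero}  _         = ℕ.n<1+n (suc m)
  ∣m-n∣<∣1+m-n∣ {suc m} {suc n} (s≤s n≤m) = ∣m-n∣<∣1+m-n∣ n≤m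

  ribbonBase : Maybe (Anchor n) → ℕ
  ribbonBase nothing  = 0
  ribbonBase (just a) = suc (depth (Anchor.q a))

  ancDepth : ∀ ma → AncElem M ma → ℕ
  ancDepth (just a) p = depth p

  ribHeight : Fin (suc n) → ℕ
  ribHeight i = ribbonBase anchor + ℕ.∣ toℕ i - target anchor ∣

  height : Elem M → ℕ
  height (rib i)     = ribHeight i
  height (att z _ p) = suc (ribHeight z + depth p)
  height (anc p)     = ancDepth anchor p

  height-Kept : ∀ {x y} → Kept M x y → height y ℕ.< height x
  height-Kept (ribUp e _ , nu) rewrite Fin.toℕ-inject₁ e =
    ℕ.+-monoʳ-< (ribbonBase anchor) (∣1+m-n∣<∣m-n∣ (¬FoldUp⇒<target anchor e nu))
  height-Kept (ribDown e _ , nd) rewrite Fin.toℕ-inject₁ e =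
    ℕ.+-monoʳ-< (ribbonBase anchor) (∣m-n∣<∣1+m-n∣ (¬FoldDown⇒target≤ anchor e nd))
  height-Kept (attRoot z _ , _) = s≤s (ℕ.m≤m+n (ribHeight z) 0)
  height-Kept (attIn z _ c , _) = s≤s (ℕ.+-monoʳ-< (ribHeight z) (depth-TCov c))
  height-Kept (ancUp _ _ l , _) = anchorHeight anchor l
    where
    anchorHeight : ∀ ma {i p} → AncLink M ma i p →
                   ancDepth ma p ℕ.< ribbonBase ma + ℕ.∣ toℕ i - target ma ∣
    anchorHeight (just a) (_ , refl) = s≤s (ℕ.m≤m+n _ _)
  height-Kept (ancIn _ _ c , _) = ancHeight anchor c
    where
    ancHeight : ∀ ma {p q} → AncCov M ma p q → ancDepth ma q ℕ.< ancDepth ma p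
    ancHeight (just a) = depth-TCov

  ribbonIndex : Elem M → ℕ
  ribbonIndex (rib i)     = toℕ i
  ribbonIndex (att z _ _) = toℕ z
  ribbonIndex (anc _)     = target anchor

  ancAddress : ∀ ma → AncElem M ma → List ℕ
  ancAddress (just a) p = address p

  code : Elem M → List ℕ
  code x = ribbonIndex x ∷ tag x
    where
    tag : Elem M → List ℕ
    tag (rib _)     = 0 ∷ []
    tag (att _ m p) = 1 ∷ address (sub m p)
    tag (anc p)     = 2 ∷ ancAddress anchor p

  code-injective : ∀ {x y} → code x ≡ code y → x ≡ y
  code-injective {rib i}     {rib i′}       eq = cong rib (Fin.toℕ-injective (∷-injectiveˡ eq))
  code-injective {att z m p} {att z′ m′ p′} eq
    with refl ← Fin.toℕ-injective (∷-injectiveˡ eq)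
    with refl ← address-injective (sub m p) (sub m′ p′) (∷-injectiveʳ (∷-injectiveʳ eq)) = refl
  code-injective {anc p}     {anc p′}       eq =
    cong anc (ancAddress-injective anchor (∷-injectiveʳ (∷-injectiveʳ eq)))
    where
    ancAddress-injective : ∀ ma {p p′ : AncElem M ma} → ancAddress ma p ≡ ancAddress ma p′ → p ≡ p′
    ancAddress-injective (just a) = address-injective _ _
  code-injective {rib _}     {att _ _ _}    ()
  code-injective {rib _}     {anc _}        ()
  code-injective {att _ _ _} {rib _}        ()
  code-injective {att _ _ _} {anc _}        ()
  code-injective {anc _}     {rib _}        ()
  code-injective {anc _}     {att _ _ _}    ()

  attachedElements : Fin (suc n) → List (Elem M)
  attachedElements z = map (λ { (_ , m , p) → att z m p }) (subPositions (trees z))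

  ancPositions : ∀ ma → List (AncElem M ma)
  ancPositions nothing  = []
  ancPositions (just a) = positions (Anchor.Q a)

  elements : List (Elem M)
  elements = map rib (allFin _) ++ concatMap attachedElements (allFin _) ++ map anc (ancPositions anchor)

  ∈-elements : ∀ x → x ∈ elements
  ∈-elements (rib i)     = ∈-++⁺ˡ (∈-map⁺ rib (∈-allFin i))
  ∈-elements (att z m p) = ∈-++⁺ʳ (map rib (allFin _)) (∈-++⁺ˡ (∈-concatMap⁺ attachedElements
    (Any.map (λ { refl → ∈-map⁺ _ (∈-subPositions m p) }) (∈-allFin z))))
  ∈-elements (anc p)     = ∈-++⁺ʳ (map rib (allFin _)) (∈-++⁺ʳ (concatMap attachedElements (allFin _))
    (∈-map⁺ anc (∈-ancPositions anchor p)))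
    where
    ∈-ancPositions : ∀ ma (p : AncElem M ma) → p ∈ ancPositions ma
    ∈-ancPositions (just a) p = ∈-positions p

  Cut : Fin n → Set
  Cut e = (inS e ≡ false → FoldUp M anchor e) × (inS e ≡ true → FoldDown M anchor e)

  edge-connected-or-cut : ∀ e → _~_ M (rib (inject₁ e)) (rib (fsuc e)) ⊎ Cut e
  edge-connected-or-cut e with inS e in s | foldUp? anchor e | foldDown? anchor e
  ... | false | no nu  | _      = inj₁ (inj₁ (ribUp e s , nu) ◅ ε)
  ... | false | yes fu | _      = inj₂ ((λ _ → fu) , λ ())
  ... | true  | _      | no nd  = inj₁ (inj₂ (ribDown e s , nd) ◅ ε)
  ... | true  | _      | yes fd = inj₂ ((λ ()) , λ _ → fd)

  LeftOf : Fin n → Elem M → Set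
  LeftOf e x = ribbonIndex x ℕ.≤ toℕ e

  LeftOf-inject₁ : ∀ {e e′} → toℕ e′ ≢ toℕ e →
                   LeftOf e (rib (inject₁ e′)) ⇔ LeftOf e (rib (fsuc e′))
  LeftOf-inject₁ {e} {e′} e′≢e rewrite Fin.toℕ-inject₁ e′ =
    mk⇔ (λ e′≤e → ℕ.≤∧≢⇒< e′≤e e′≢e) (ℕ.<⇒≤)

  Kept-LeftOf : ∀ {e x y} → Cut e → Kept M x y → LeftOf e x ⇔ LeftOf e y
  Kept-LeftOf {e} cut (ribUp e′ s , nu) with toℕ e′ ℕ.≟ toℕ e
  ... | yes e′≡e with refl ← Fin.toℕ-injective e′≡e = ⊥-elim (nu (proj₁ cut s))
  ... | no e′≢e = LeftOf-inject₁ e′≢e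
  Kept-LeftOf {e} cut (ribDown e′ s , nd) with toℕ e′ ℕ.≟ toℕ e
  ... | yes e′≡e with refl ← Fin.toℕ-injective e′≡e = ⊥-elim (nd (proj₂ cut s))
  ... | no e′≢e = ⇔-sym (LeftOf-inject₁ e′≢e)
  Kept-LeftOf cut (attRoot _ _ , _) = ⇔-refl
  Kept-LeftOf cut (attIn _ _ _ , _) = ⇔-refl
  Kept-LeftOf {e} cut (ancUp _ _ l , _) rewrite AncLink⇒target anchor l = ⇔-refl
  Kept-LeftOf cut (ancIn _ _ _ , _) = ⇔-refl

  ~-LeftOf : ∀ {e x y} → Cut e → _~_ M x y → LeftOf e x ⇔ LeftOf e y
  ~-LeftOf cut ε                = ⇔-refl
  ~-LeftOf cut (inj₁ x⋖y ◅ y~z) = ⇔-trans (Kept-LeftOf cut x⋖y) (~-LeftOf cut y~z)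
  ~-LeftOf cut (inj₂ y⋖x ◅ y~z) = ⇔-trans (⇔-sym (Kept-LeftOf cut y⋖x)) (~-LeftOf cut y~z)

  SeparatedByCut : Fin (suc n) → Fin (suc n) → Set
  SeparatedByCut a b = ∃ λ e → Cut e × LeftOf e (rib a) × ¬ LeftOf e (rib b)

  ribbon-connected-or-separated : ∀ {a b} → a Fin.≤ b → _~_ M (rib a) (rib b) ⊎ SeparatedByCut a b
  ribbon-connected-or-separated {a} = <-weakInduction-startingFrom P (inj₁ ε) extend
    where
    P : Fin (suc n) → Set
    P b = _~_ M (rib a) (rib b) ⊎ SeparatedByCut a b

    extend : ∀ j → P (inject₁ j) → P (fsuc j)
    extend j (inj₂ (e , cut , a≤e , j≰e)) =
      inj₂ (e , cut , a≤e , λ j+1≤e →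
        j≰e (subst (ℕ._≤ toℕ e) (sym (Fin.toℕ-inject₁ j)) (ℕ.<⇒≤ j+1≤e)))
    extend j (inj₁ a~j) with edge-connected-or-cut j
    ... | inj₁ j~j+1 = inj₁ (a~j ◅◅ j~j+1)
    ... | inj₂ cut   = inj₂ (j , cut , Equivalence.from (~-LeftOf cut a~j) j≤j , ℕ.n≮n (toℕ j))
      where
      j≤j : LeftOf j (rib (inject₁ j))
      j≤j = ℕ.≤-reflexive (Fin.toℕ-inject₁ j)

module MobileForest (M : Mobile) =
  RootedForest (Kept M) (Kept-functional M) (Kept-upper? M) (height M) (height-Kept M) (code M) (code-injective M)

module MobilePathOrder (M : Mobile) =
  MobileForest.PathOrder M (Lex-isStrictTotalOrder ℕ.<-isStrictTotalOrder)

module _ (M : Mobile) where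

  open MobileForest M
  open MobilePathOrder M

  ~-sym : ∀ {x y} → _~_ M x y → _~_ M y x
  ~-sym = Star.reverse swap

  ⋖*⇒~ : ∀ {x y} → x ⋖* y → _~_ M x y
  ⋖*⇒~ = Star.map inj₁

  ≺-monotone⇒σ-Partitioned : ∀ {N} (ω : Elem M → Fin N) → (∀ {x y} → x ≺ y → ω x Fin.< ω y) →
                             σ-Partitioned M ω
  ≺-monotone⇒σ-Partitioned ω mono {x} {y} a b a<b x~a y~b x≁y
    with ribbon-connected-or-separated M (ℕ.<⇒≤ a<b)
  ... | inj₁ a~b = ⊥-elim (x≁y (x~a ◅◅ a~b ◅◅ ~-sym y~b))
  ... | inj₂ (e , cut , a≤e , b≰e) =
    mono (≺-by-ancestors λ x⋖*r y⋖*r′ → this (ℕ.≤-<-trans (r≤e x⋖*r) (e<r′ y⋖*r′)))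
    where
    r≤e : ∀ {r} → x ⋖* r → LeftOf M e r
    r≤e x⋖*r = Equivalence.from (~-LeftOf M cut (~-sym (⋖*⇒~ x⋖*r) ◅◅ x~a)) a≤e

    e<r′ : ∀ {r′} → y ⋖* r′ → toℕ e ℕ.< ribbonIndex M r′
    e<r′ y⋖*r′ = ℕ.≰⇒> λ r′≤e →
      b≰e (Equivalence.to (~-LeftOf M cut (~-sym (⋖*⇒~ y⋖*r′) ◅◅ y~b)) r′≤e)

  ≺-cancel⇒RegularOnComponents : ∀ {N} (ω : Elem M → Fin N) →
                                 (∀ {x y} → ω x Fin.< ω y → x ≺ y) → RegularOnComponents M ω
  -- Regularity holds on the whole of P ⊖ F.
  ≺-cancel⇒RegularOnComponents ω cancel _ _ (x⋖*z , x≢z) (inj₁ (ωx<ωy , ωy<ωz)) =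
    inj₂ (≺-regular x⋖*z x≢z (inj₁ (cancel ωx<ωy , cancel ωy<ωz)))
  ≺-cancel⇒RegularOnComponents ω cancel _ _ (x⋖*z , x≢z) (inj₂ (ωz<ωy , ωy<ωx)) =
    inj₂ (≺-regular x⋖*z x≢z (inj₂ (cancel ωz<ωy , cancel ωy<ωx)))

proposition5p8 : (M : Mobile) →
    Σ ℕ λ N → Σ (Elem M ⤖ Fin N) λ ω → σ-PartitionedRegular M (Bijection.to ω)
proposition5p8 M
  with N , ω , ω-iso ← rank-isOrderIsomorphism (MobilePathOrder.≺-isStrictTotalOrder M)
                                               (elements M) (∈-elements M) =
  let open IsOrderIsomorphism ω-iso in
  N , mk⤖ (injective , surjective) ,
  ≺-monotone⇒σ-Partitioned M ω mono , ≺-cancel⇒RegularOnComponents M ω cancel
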